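{- Let $\Gamma=(V,E)$ be a reflexive locally finite $k$-separable graph and let $X$ and $Y$ be $k$-fragments of $\Gamma$. Then $\partial^-(\nabla(X))=\partial(X)$, $\nabla^-(\nabla(X))=X$, and $X\subseteq Y$ if and only if $\nabla(Y)\subseteq\nabla(X)$. In particular, $\nabla(X)$ is a reverse-$k$-semi-fragment of $\Gamma$.
   Context: A graph is a pair $\Gamma=(V,E)$ with $V$ a set and $E\subseteq V\times V$. For $X\subseteq V$, $\Gamma(X)=\{y: (x,y)\in E \text{ for some } x\in X\}$, $\Gamma(x)=\Gamma(\{x\})$. $\Gamma$ is reflexive if $(x,x)\in E$ for all $x$. The reverse graph is $\Gamma^-=(V,E^-)$, $E^-=\{(x,y):(y,x)\in E\}$. $\Gamma$ is locally finite if $\Gamma(x)$ and $\Gamma^-(x)$ are finite for every $x$. Board: $\partial(X)=\Gamma(X)\setminus X$; exterior: $\nabla(X)=V\setminus\Gamma(X)$; $\partial^-$ and $\nabla^-$ denote the board and exterior computed in $\Gamma^-$. For $k\ge1$, $\Gamma$ is $k$-separable if some finite $X$ has $|X|\ge k$ and $|\nabla(X)|\ge k$; then $\kappa_k(\Gamma)$ is the minimum of $|\partial(X)|$ over finite $X$ with $|X|\ge k$, $|\nabla(X)|\ge k$. A $k$-fragment is a finite $X$ with $|X|\ge k$, $|\nabla(X)|\ge k$, $|\partial(X)|=\kappa_k(\Gamma)$. A $k$-semi-fragment of a graph is a set $X$ such that either $X$ is a $k$-fragment of the graph or $\nabla(X)$ is a $k$-fragment of its reverse graph. A reverse-$k$-semi-fragment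 (resp. reverse $k$-fragment) of $\Gamma$ is a $k$-semi-fragment (resp. $k$-fragment) of $\Gamma^-$; thus $Z$ is a reverse-$k$-semi-fragment of $\Gamma$ iff $Z$ is a $k$-fragment of $\Gamma^-$ or $\nabla^-(Z)$ is a $k$-fragment of $\Gamma$. -}

module Defs where

open import Level using (0ℓ)
open import Data.Nat using (ℕ; _≤_)
open import Data.Fin using (Fin)
open import Data.Product using (Σ; ∃; _×_)
open import Data.Sum using (_⊎_)
open import Relation.Unary using (Pred)
open import Relation.Nullary using (¬_)
open import Relation.Binary.PropositionalEquality using (_≡_)
open import Function.Definitions using (Injective)

-- A graph on vertex set V is given by its edge relation E : V → V → Set
-- ((x , y) ∈ E  is  E x y).  Subsets of V are predicates  Pred V 0ℓ.

module _ {V : Set} where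

  rev : (V → V → Set) → (V → V → Set)
  rev E x y = E y x

  Img : (V → V → Set) → Pred V 0ℓ → Pred V 0ℓ
  Img E X y = ∃ λ x → X x × E x y

  Bd : (V → V → Set) → Pred V 0ℓ → Pred V 0ℓ
  Bd E X y = Img E X y × ¬ X y

  Ext : (V → V → Set) → Pred V 0ℓ → Pred V 0ℓ
  Ext E X y = ¬ Img E X y

  HasCard : Pred V 0ℓ → ℕ → Set
  HasCard X n = Σ (Fin n → V) λ f →
    Injective _≡_ _≡_ f × (∀ i → X (f i)) × (∀ x → X x → ∃ λ i → f i ≡ x)

  AtLeast : Pred V 0ℓ → ℕ → Set
  AtLeast X k = Σ (Fin k → V) λ f → Injective _≡_ _≡_ f × (∀ i → X (f i))

  Finite : Pred V 0ℓ → Set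
  Finite X = ∃ λ n → HasCard X n

  IsReflexive : (V → V → Set) → Set
  IsReflexive E = ∀ x → E x x

  LocallyFinite : (V → V → Set) → Set
  LocallyFinite E = ∀ x → Finite (E x) × Finite (λ y → E y x)

  Admissible : (V → V → Set) → ℕ → Pred V 0ℓ → Set
  Admissible E k X = Finite X × AtLeast X k × AtLeast (Ext E X) k

  Separable : (V → V → Set) → ℕ → Set₁
  Separable E k = ∃ λ X → Admissible E k X

  IsFragment : (V → V → Set) → ℕ → Pred V 0ℓ → Set₁
  IsFragment E k X = Admissible E k X × Σ ℕ λ m → HasCard (Bd E X) m ×
    (∀ Y → Admissible E k Y → ∀ n → HasCard (Bd E Y) n → m ≤ n)

  SemiFragment : (V → V → Set) → ℕ → Pred V 0ℓ → Set₁
  SemiFragment E k X = IsFragment E k X ⊎ IsFragment (rev E) k (Ext E X)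

  ReverseSemiFragment : (V → V → Set) → ℕ → Pred V 0ℓ → Set₁
  ReverseSemiFragment E k Z = SemiFragment (rev E) k Z

-- The heart of the proof is one combinatorial fact: every vertex y on the
-- board of a fragment X has an out-neighbour in ∇X.  Otherwise Γ(y) ⊆ Γ(X),
-- so X ∪ {y} has the same image and exterior as X but its board is ∂X ∖ {y};
-- it is still admissible and has a strictly smaller board, contradicting the
-- minimality of |∂X| = κ_k.  Everything else is set algebra: the inclusions
-- X ⊆ ∇⁻(∇X), ∂⁻(∇X) ⊆ ∂X and ∇⁻(∇X) ⊆ Γ(X) hold in any (reflexive) graph,
-- and the escape property supplies the reverse inclusions.
--
-- Excluded middle (a
-- hypothesis of the theorem) is used only to eliminate double negations.

module Submission where

open import Defs
open import Level using (0ℓ)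
open import Data.Nat using (ℕ; _≤_; zero; suc)
open import Data.Nat.Properties using (n≮n)
open import Data.Fin using (Fin; punchIn; punchOut)
open import Data.Fin.Properties using (punchIn-injective; punchInᵢ≢i; punchIn-punchOut)
open import Data.Product using (_×_; _,_; proj₁; proj₂; ∃)
open import Data.Sum using (inj₁; inj₂)
open import Relation.Nullary using (¬_)
open import Relation.Binary.PropositionalEquality using (_≡_; refl; sym; trans; cong; subst)
open import Relation.Unary using (Pred; _⊆_; _≐_; _∪_; _∖_; ｛_｝)
open import Relation.Unary.Properties using (≐-sym)
open import Function.Bundles using (_⇔_; mk⇔)
open import Axiom.ExcludedMiddle using (ExcludedMiddle)
open import Axiom.DoubleNegationElimination using (em⇒dne)

module _ {V : Set} where

  img-mono : (E : V → V → Set) {A B : Pred V 0ℓ} → A ⊆ B → Img E A ⊆ Img E B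
  img-mono E A⊆B (x , x∈A , e) = x , A⊆B x∈A , e

  ext-anti : (E : V → V → Set) {A B : Pred V 0ℓ} → A ⊆ B → Ext E B ⊆ Ext E A
  ext-anti E A⊆B y∉ΓB y∈ΓA = y∉ΓB (img-mono E A⊆B y∈ΓA)

  ext-cong : (E : V → V → Set) {A B : Pred V 0ℓ} → A ≐ B → Ext E A ≐ Ext E B
  ext-cong E (A⊆B , B⊆A) = ext-anti E B⊆A , ext-anti E A⊆B

  bd-cong : (E : V → V → Set) {A B : Pred V 0ℓ} → A ≐ B → Bd E A ≐ Bd E B
  bd-cong E (A⊆B , B⊆A) =
    (λ (y∈ΓA , y∉A) → img-mono E A⊆B y∈ΓA , λ y∈B → y∉A (B⊆A y∈B)) ,
    (λ (y∈ΓB , y∉B) → img-mono E B⊆A y∈ΓB , λ y∈A → y∉B (A⊆B y∈A))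

  hasCard-cong : {A B : Pred V 0ℓ} {n : ℕ} → A ≐ B → HasCard A n → HasCard B n
  hasCard-cong (A⊆B , B⊆A) (f , f-inj , f∈A , f-onto) =
    f , f-inj , (λ i → A⊆B (f∈A i)) , (λ x x∈B → f-onto x (B⊆A x∈B))

  atLeast-mono : {A B : Pred V 0ℓ} {n : ℕ} → A ⊆ B → AtLeast A n → AtLeast B n
  atLeast-mono A⊆B (f , f-inj , f∈A) = f , f-inj , (λ i → A⊆B (f∈A i))

  fragment-cong : (E : V → V → Set) (k : ℕ) {A B : Pred V 0ℓ} → A ≐ B →
                  IsFragment E k A → IsFragment E k B
  fragment-cong E k {A} {B} A≐B (((p , cardA) , atA , atExtA) , m , cardBd , minimal) =
    ((p , hasCard-cong A≐B cardA) , atLeast-mono {A} {B} (proj₁ A≐B) atA ,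
     atLeast-mono {Ext E A} {Ext E B} (proj₁ (ext-cong E A≐B)) atExtA) ,
    m , hasCard-cong (bd-cong E A≐B) cardBd , minimal

  hasCard-zero-empty : {A : Pred V 0ℓ} {a : V} → HasCard A 0 → ¬ A a
  hasCard-zero-empty (_ , _ , _ , f-onto) a∈A with f-onto _ a∈A
  ... | () , _

  hasCard-delete : {A : Pred V 0ℓ} {n : ℕ} {a : V} → HasCard A (suc n) → A a →
                   HasCard (A ∖ ｛ a ｝) n
  hasCard-delete {A} {n} {a} (f , f-inj , f∈A , f-onto) a∈A
    with f-onto a a∈A
  ... | i₀ , fi₀≡a = g , g-inj , g∈A∖a , g-onto
    where
    g : Fin n → V
    g j = f (punchIn i₀ j)

    g-inj : ∀ {j₁ j₂} → g j₁ ≡ g j₂ → j₁ ≡ j₂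
    g-inj {j₁} {j₂} e = punchIn-injective i₀ j₁ j₂ (f-inj e)

    g∈A∖a : ∀ j → (A ∖ ｛ a ｝) (g j)
    g∈A∖a j = f∈A _ , λ a≡gj → punchInᵢ≢i i₀ j (f-inj (trans (sym a≡gj) (sym fi₀≡a)))

    g-onto : ∀ x → (A ∖ ｛ a ｝) x → ∃ λ j → g j ≡ x
    g-onto x (x∈A , a≢x) with f-onto x x∈A
    ... | i , fi≡x = punchOut i₀≢i , trans (cong f (punchIn-punchOut i₀≢i)) fi≡x
      where
      i₀≢i : ¬ i₀ ≡ i
      i₀≢i e = a≢x (trans (sym fi₀≡a) (trans (cong f e) fi≡x))

  hasCard-insert : {A : Pred V 0ℓ} {p : ℕ} {y : V} → HasCard A p → ¬ A y →
                   HasCard (A ∪ ｛ y ｝) (suc p)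
  hasCard-insert {A} {p} {y} (f , f-inj , f∈A , f-onto) y∉A = g , g-inj , g∈ , g-onto
    where
    g : Fin (suc p) → V
    g Fin.zero    = y
    g (Fin.suc i) = f i

    g-inj : ∀ {i j} → g i ≡ g j → i ≡ j
    g-inj {Fin.zero}  {Fin.zero}  _ = refl
    g-inj {Fin.zero}  {Fin.suc j} e with () ← y∉A (subst A (sym e) (f∈A j))
    g-inj {Fin.suc i} {Fin.zero}  e with () ← y∉A (subst A e (f∈A i))
    g-inj {Fin.suc i} {Fin.suc j} e = cong Fin.suc (f-inj e)

    g∈ : ∀ i → (A ∪ ｛ y ｝) (g i)
    g∈ Fin.zero    = inj₂ refl
    g∈ (Fin.suc i) = inj₁ (f∈A i)

    g-onto : ∀ x → (A ∪ ｛ y ｝) x → ∃ λ i → g i ≡ x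
    g-onto x (inj₁ x∈A) with f-onto x x∈A
    ... | i , fi≡x = Fin.suc i , fi≡x
    g-onto x (inj₂ refl) = Fin.zero , refl

  module _ (E : V → V → Set) where

    module Absorb {X : Pred V 0ℓ} {y : V} (Γy⊆ΓX : E y ⊆ Img E X) where

      img-absorb : Img E (X ∪ ｛ y ｝) ⊆ Img E X
      img-absorb (x , inj₁ x∈X , e) = x , x∈X , e
      img-absorb (x , inj₂ refl , e) = Γy⊆ΓX e

      ext-absorb : Ext E X ⊆ Ext E (X ∪ ｛ y ｝)
      ext-absorb v∉ΓX v∈ΓX⁺ = v∉ΓX (img-absorb v∈ΓX⁺)

      bd-absorb : Bd E X ∖ ｛ y ｝ ≐ Bd E (X ∪ ｛ y ｝)
      bd-absorb =
        (λ ((v∈ΓX , v∉X) , y≢v) →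
           img-mono E inj₁ v∈ΓX , λ { (inj₁ v∈X) → v∉X v∈X ; (inj₂ y≡v) → y≢v y≡v }) ,
        (λ (v∈ΓX⁺ , v∉X⁺) →
           (img-absorb v∈ΓX⁺ , λ v∈X → v∉X⁺ (inj₁ v∈X)) , λ y≡v → v∉X⁺ (inj₂ y≡v))

      admissible-absorb : {k : ℕ} → ¬ X y → Admissible E k X → Admissible E k (X ∪ ｛ y ｝)
      admissible-absorb y∉X ((p , cardX) , atX , atExtX) =
        (suc p , hasCard-insert cardX y∉X) ,
        atLeast-mono {X} {X ∪ ｛ y ｝} inj₁ atX ,
        atLeast-mono {Ext E X} {Ext E (X ∪ ｛ y ｝)} ext-absorb atExtX

    -- A board vertex of a k-fragment can never be absorbed: X ∪ {y} would be
    -- admissible with a board of size κ_k − 1.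
    fragment-no-absorption : {k : ℕ} {X : Pred V 0ℓ} {y : V} → IsFragment E k X →
                             Bd E X y → ¬ (E y ⊆ Img E X)
    fragment-no-absorption (_ , zero , card∂X , _) y∈∂X _ = hasCard-zero-empty card∂X y∈∂X
    fragment-no-absorption {X = X} {y} (admX , suc n , card∂X , minimal) y∈∂X Γy⊆ΓX =
      n≮n n (minimal (X ∪ ｛ y ｝) (admissible-absorb (proj₂ y∈∂X) admX) n card∂X⁺)
      where
      open Absorb Γy⊆ΓX
      card∂X⁺ : HasCard (Bd E (X ∪ ｛ y ｝)) n
      card∂X⁺ = hasCard-cong bd-absorb (hasCard-delete card∂X y∈∂X)

    ⊆-ext-ext : (X : Pred V 0ℓ) → X ⊆ Ext (rev E) (Ext E X)
    ⊆-ext-ext X {y} y∈X (x , x∉ΓX , e) = x∉ΓX (y , y∈X , e)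

    module Classical (em : ExcludedMiddle 0ℓ) where

      private
        dne : {P : Set} → ¬ ¬ P → P
        dne = em⇒dne em

      fragment-board-escapes : {k : ℕ} {X : Pred V 0ℓ} → IsFragment E k X →
                               Bd E X ⊆ Img (rev E) (Ext E X)
      fragment-board-escapes fragX {y} y∈∂X = dne λ no-escape →
        fragment-no-absorption fragX y∈∂X λ {v} e →
          dne λ v∉ΓX → no-escape (v , v∉ΓX , e)

      rev-bd-ext-⊆ : (X : Pred V 0ℓ) → Bd (rev E) (Ext E X) ⊆ Bd E X
      rev-bd-ext-⊆ X {y} ((x , x∉ΓX , e) , y∉∇X) =
        dne y∉∇X , λ y∈X → x∉ΓX (y , y∈X , e)

      -- In a reflexive graph, ∇⁻(∇X) ⊆ Γ(X): a point outside Γ(X) is its own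
      -- out-neighbour in ∇X.
      ext-ext-⊆-img : IsReflexive E → (X : Pred V 0ℓ) → Ext (rev E) (Ext E X) ⊆ Img E X
      ext-ext-⊆-img refl-E X {y} y∈∇⁻∇X = dne λ y∉ΓX → y∈∇⁻∇X (y , y∉ΓX , refl-E y)

      -- ∂⁻(∇X) = ∂X for a fragment: a board vertex of X has an out-neighbour in
      -- ∇X (it escapes) and does not itself lie in ∇X.
      fragment-rev-bd : {k : ℕ} {X : Pred V 0ℓ} → IsFragment E k X →
                        Bd (rev E) (Ext E X) ≐ Bd E X
      fragment-rev-bd {X = X} fragX =
        rev-bd-ext-⊆ X , λ y∈∂X → fragment-board-escapes fragX y∈∂X , λ y∈∇X → y∈∇X (proj₁ y∈∂X)

      -- ∇⁻(∇X) ⊆ Γ(X), and no board vertex lies in ∇⁻(∇X) since it escapes.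
      fragment-ext-ext : {k : ℕ} {X : Pred V 0ℓ} → IsReflexive E → IsFragment E k X →
                         Ext (rev E) (Ext E X) ≐ X
      fragment-ext-ext {X = X} refl-E fragX =
        (λ y∈∇⁻∇X → dne λ y∉X →
           y∈∇⁻∇X (fragment-board-escapes fragX (ext-ext-⊆-img refl-E X y∈∇⁻∇X , y∉X))) ,
        ⊆-ext-ext X

lemma3p2 : ExcludedMiddle 0ℓ →
    {V : Set} (E : V → V → Set) (k : ℕ) → 1 ≤ k →
    IsReflexive E → LocallyFinite E → Separable E k →
    (X Y : Pred V 0ℓ) → IsFragment E k X → IsFragment E k Y →
    (Bd (rev E) (Ext E X) ≐ Bd E X) ×
    (Ext (rev E) (Ext E X) ≐ X) ×
    (X ⊆ Y ⇔ Ext E Y ⊆ Ext E X) ×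
    ReverseSemiFragment E k (Ext E X)
lemma3p2 em E k _ refl-E _ _ X Y fragX fragY =
  fragment-rev-bd fragX , ∇⁻∇X≐X , mk⇔ (ext-anti E) reflect ,
  inj₂ (fragment-cong E k (≐-sym ∇⁻∇X≐X) fragX)
  where
  open Classical E em
  ∇⁻∇X≐X : Ext (rev E) (Ext E X) ≐ X
  ∇⁻∇X≐X = fragment-ext-ext refl-E fragX
  -- X = ∇⁻(∇X) ⊆ ∇⁻(∇Y) = Y, since ∇⁻ is antitone.
  reflect : Ext E Y ⊆ Ext E X → X ⊆ Y
  reflect ∇Y⊆∇X x∈X =
    proj₁ (fragment-ext-ext refl-E fragY) (ext-anti (rev E) ∇Y⊆∇X (proj₂ ∇⁻∇X≐X x∈X))
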